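{- For every integer $r\ge 3$, $\mu_{\rm t}(K_s^{\square, r}) = \Theta(s^{r-2})$ as $s\to\infty$.
   Context: For a connected graph $G$ and $X\subseteq V(G)$, two vertices $x,y$ are $X$-visible if there is a shortest $x,y$-path none of whose internal vertices lies in $X$. $X$ is a total mutual-visibility set if every two vertices of $V(G)$ are $X$-visible. $\mu_{\rm t}(G)$ is the maximum cardinality of a total mutual-visibility set of $G$. $K_s^{\square, r}$ is the Cartesian product of $r$ copies of the complete graph $K_s$ (vertices are $r$-tuples over $[s]$, adjacent iff they differ in exactly one coordinate). -}

module Defs where

open import Level using (Level)
open import Data.Nat using (ℕ; suc)
open import Data.Fin using (Fin)
open import Data.Vec using (Vec; lookup)
open import Data.List using (List; []; _∷_; length)
open import Data.List.Membership.Propositional using (_∈_; _∉_)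
open import Data.List.Relation.Unary.All using (All)
open import Data.List.Relation.Unary.Unique.Propositional using (Unique)
open import Data.Product using (Σ; ∃; _×_)
open import Relation.Binary.PropositionalEquality using (_≡_; _≢_)

module Graph {V : Set} (Adj : V → V → Set) where

  data Walk : V → V → Set where
    []  : ∀ {x} → Walk x x
    _∷_ : ∀ {x y z} → Adj x y → Walk y z → Walk x z

  len : ∀ {x y} → Walk x y → ℕ
  len []      = 0
  len (_ ∷ w) = suc (len w)

  inner : ∀ {x y} → Walk x y → List V
  inner []                          = []
  inner (_ ∷ [])                    = []
  inner (_∷_ {y = y} _ (e ∷ w))     = y ∷ inner (e ∷ w)

  Shortest : ∀ {x y} → Walk x y → Set
  Shortest {x} {y} p = ∀ (q : Walk x y) → len p Data.Nat.≤ len q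

  Visible : List V → V → V → Set
  Visible X x y = Σ (Walk x y) λ p → Shortest p × All (λ v → v ∉ X) (inner p)

  IsTotalMV : List V → Set
  IsTotalMV X = Unique X × (∀ x y → Visible X x y)

  IsMuT : ℕ → Set
  IsMuT m = (Σ (List V) λ X → IsTotalMV X × length X ≡ m)
          × (∀ X → IsTotalMV X → length X Data.Nat.≤ m)

-- The Hamming graph K_s^{□,r}: vertices are r-tuples over Fin s,
-- adjacent iff they differ in exactly one coordinate.
HammingAdj : (s r : ℕ) → Vec (Fin s) r → Vec (Fin s) r → Set
HammingAdj s r u v =
  ∃ λ (i : Fin r) → lookup u i ≢ lookup v i × (∀ j → j ≢ i → lookup u j ≡ lookup v j)

MuTHamming : (s r m : ℕ) → Set
MuTHamming s r m = Graph.IsMuT (HammingAdj s r) m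

-- In a Hamming graph a vertex set X is a total mutual-visibility set exactly when no two
-- of its vertices are at Hamming distance 2. If P, Q ∈ X are at distance 2, there are two
-- vertices at distance 2 whose only common neighbours are P and Q. Conversely, a vertex at
-- distance d ≥ 2 from y has two neighbours at distance d - 1 from y which are at distance 2
-- from each other, so one of them avoids X and a geodesic avoiding X is built greedily.
--
-- Upper bound: for such X in K_s^{3+k}, every x ∈ X is, for some axis i < 3, the only point
-- of X agreeing with x in coordinate i and in the last k coordinates. Otherwise the witness
-- for axis 0 is a neighbour of x along an axis j ∈ {1, 2}, and the witness for axis j lies
-- at distance 2 from x or from that neighbour. So x ↦ (i, xᵢ, x₃, …) is injective on X.
--
-- Lower bound: with N = k + 1 and m = ⌊s / N²⌋ ≥ s / 2N², the vertices (Σ uᵢ, Σ (i+1) uᵢ, u)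
-- for u ∈ [m]^N have no two at distance 2: changing one coordinate of u moves both sums
-- strictly in the same direction, and changing two cannot preserve both.

{-# OPTIONS --safe #-}
module Submission where

open import Defs
open import Algebra.Properties.CommutativeSemigroup using (interchange)
open import Data.Empty using (⊥)
open import Data.Fin using (Fin; zero; suc; toℕ; fromℕ<; inject≤)
open import Data.Fin.Properties as Fin using (_≟_)
open import Data.List as List using (List; length; allFin; cartesianProductWith; _++_)
import Data.List.Membership.DecPropositional as DecMembership
open import Data.List.Membership.Propositional using (_∈_; _∉_; find; lose)
open import Data.List.Membership.Propositional.Properties
  using (∈-∃++; ∈-allFin; ∈-cartesianProductWith⁺; ∈-map⁻)
open import Data.List.Properties using (length-++; length-map; length-tabulate)
open import Data.List.Relation.Binary.Permutation.Propositional.Properties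
  using (shift; ∈-resp-↭; ↭-length)
open import Data.List.Relation.Unary.All as All using (All)
open import Data.List.Relation.Unary.AllPairs as AllPairs using ()
open import Data.List.Relation.Unary.Any using (Any; here; there; any?)
open import Data.List.Relation.Unary.Unique.Propositional using (Unique)
import Data.List.Relation.Unary.Unique.Propositional.Properties as Unique
open import Data.Nat as ℕ using (ℕ; zero; suc; _≤_; _<_; _+_; _*_; _^_; _∸_; z≤n; s≤s; _/_; _%_)
open import Data.Nat.DivMod using (m/n*n≤m; m≥n⇒m/n>0; m≡m%n+[m/n]*n; m%n<n)
open import Data.Nat.Properties hiding (_≟_)
open import Data.Product using (Σ; Σ-syntax; _×_; _,_; proj₁; proj₂)
open import Data.Sum as Sum using (_⊎_; inj₁; inj₂)
open import Data.Vec as Vec using (Vec; []; _∷_; lookup; map)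
import Data.Vec.Properties as Vec
open import Function using (_∘_; id)
open import Function.Definitions using (Injective)
open import Relation.Binary.Definitions using (tri<; tri≈; tri>)
open import Relation.Binary.PropositionalEquality
open import Relation.Nullary using (Dec; yes; no; ¬_; contradiction; ¬?; _×-dec_)
open import Relation.Nullary.Decidable using (decidable-stable)

private
  variable
    s t u n : ℕ

mismatch : Fin t → Fin t → ℕ
mismatch a b with a ≟ b
... | yes _ = 0
... | no  _ = 1

mismatch-self : (a : Fin t) → mismatch a a ≡ 0
mismatch-self a with a ≟ a
... | yes _   = refl
... | no a≢a = contradiction refl a≢a

mismatch-≢ : {a b : Fin t} → a ≢ b → mismatch a b ≡ 1
mismatch-≢ {a = a} {b} a≢b with a ≟ b
... | yes a≡b = contradiction a≡b a≢b
... | no  _   = refl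

mismatch≤1 : (a b : Fin t) → mismatch a b ≤ 1
mismatch≤1 a b with a ≟ b
... | yes _ = z≤n
... | no  _ = ≤-refl

mismatch-triangle : (a b c : Fin t) → mismatch a c ≤ mismatch a b + mismatch b c
mismatch-triangle a b c with a ≟ b
... | yes refl = ≤-refl
... | no  _    = ≤-trans (mismatch≤1 a c) (s≤s z≤n)

mismatch-map : {f : Fin t → Fin u} → Injective _≡_ _≡_ f →
               (a b : Fin t) → mismatch (f a) (f b) ≡ mismatch a b
mismatch-map {f = f} f-injective a b with a ≟ b
... | yes refl = mismatch-self (f a)
... | no  a≢b  = mismatch-≢ (a≢b ∘ f-injective)

hamming : Vec (Fin t) n → Vec (Fin t) n → ℕ
hamming []      []      = 0
hamming (a ∷ x) (b ∷ y) = mismatch a b + hamming x y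

hamming-self : (x : Vec (Fin t) n) → hamming x x ≡ 0
hamming-self []      = refl
hamming-self (a ∷ x) = cong₂ _+_ (mismatch-self a) (hamming-self x)

hamming-∷-≡ : (a : Fin t) (x y : Vec (Fin t) n) → hamming (a ∷ x) (a ∷ y) ≡ hamming x y
hamming-∷-≡ a x y = cong (_+ hamming x y) (mismatch-self a)

hamming-∷-≢ : {a b : Fin t} → a ≢ b → (x y : Vec (Fin t) n) →
              hamming (a ∷ x) (b ∷ y) ≡ suc (hamming x y)
hamming-∷-≢ a≢b x y = cong (_+ hamming x y) (mismatch-≢ a≢b)

hamming≡0⇒≡ : (x y : Vec (Fin t) n) → hamming x y ≡ 0 → x ≡ y
hamming≡0⇒≡ []      []      _ = refl
hamming≡0⇒≡ (a ∷ x) (b ∷ y) h with a ≟ b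
... | yes refl = cong (a ∷_) (hamming≡0⇒≡ x y h)
... | no  _    = contradiction h λ ()

hamming-suc⇒≢ : {x y : Vec (Fin t) n} {d : ℕ} → hamming x y ≡ suc d → x ≢ y
hamming-suc⇒≢ {x = x} h refl = contradiction (trans (sym (hamming-self x)) h) λ ()

hamming-triangle : (x y z : Vec (Fin t) n) → hamming x z ≤ hamming x y + hamming y z
hamming-triangle []      []      []      = z≤n
hamming-triangle (a ∷ x) (b ∷ y) (c ∷ z) = begin
  mismatch a c + hamming x z
    ≤⟨ +-mono-≤ (mismatch-triangle a b c) (hamming-triangle x y z) ⟩
  (mismatch a b + mismatch b c) + (hamming x y + hamming y z)
    ≡⟨ interchange +-commutativeSemigroup
                   (mismatch a b) (mismatch b c) (hamming x y) (hamming y z) ⟩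
  (mismatch a b + hamming x y) + (mismatch b c + hamming y z) ∎
  where open ≤-Reasoning

hamming-map : {f : Fin t → Fin u} → Injective _≡_ _≡_ f →
              (x y : Vec (Fin t) n) → hamming (map f x) (map f y) ≡ hamming x y
hamming-map f-injective []      []      = refl
hamming-map f-injective (a ∷ x) (b ∷ y) =
  cong₂ _+_ (mismatch-map f-injective a b) (hamming-map f-injective x y)

_~_ : Vec (Fin s) n → Vec (Fin s) n → Set
_~_ {s} {n} = HammingAdj s n

~-head : {a b : Fin s} {x : Vec (Fin s) n} → a ≢ b → (a ∷ x) ~ (b ∷ x)
~-head a≢b = zero , a≢b , λ where
  zero    j≢0 → contradiction refl j≢0
  (suc j) _   → refl

~-tail : {a : Fin s} {x y : Vec (Fin s) n} → x ~ y → (a ∷ x) ~ (a ∷ y)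
~-tail (i , differ , agree) = suc i , differ , λ where
  zero    _      → refl
  (suc j) j≢1+i → agree j (j≢1+i ∘ cong suc)

∷-~⁻ : {a b : Fin s} {x y : Vec (Fin s) n} → (a ∷ x) ~ (b ∷ y) →
       (a ≢ b × x ≡ y) ⊎ (a ≡ b × x ~ y)
∷-~⁻ {x = x} {y} (zero , differ , agree) =
  inj₁ (differ , lookup-≗⇒≡ λ j → agree (suc j) λ ())
  where
  lookup-≗⇒≡ : (∀ j → lookup x j ≡ lookup y j) → x ≡ y
  lookup-≗⇒≡ eq = trans (sym (Vec.tabulate∘lookup x))
                        (trans (Vec.tabulate-cong eq) (Vec.tabulate∘lookup y))
∷-~⁻ (suc i , differ , agree) =
  inj₂ (agree zero (λ ()) , i , differ , λ j j≢i → agree (suc j) (j≢i ∘ Fin.suc-injective))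

~⇒hamming≡1 : (x y : Vec (Fin s) n) → x ~ y → hamming x y ≡ 1
~⇒hamming≡1 []      []      (() , _)
~⇒hamming≡1 (a ∷ x) (b ∷ y) x~y with ∷-~⁻ {x = x} {y} x~y
... | inj₁ (a≢b , refl) = trans (hamming-∷-≢ a≢b x x) (cong suc (hamming-self x))
... | inj₂ (refl , x~y) = trans (hamming-∷-≡ a x y) (~⇒hamming≡1 x y x~y)

hamming≡1⇒~ : (x y : Vec (Fin s) n) → hamming x y ≡ 1 → x ~ y
hamming≡1⇒~ []      []      ()
hamming≡1⇒~ (a ∷ x) (b ∷ y) h with a ≟ b
... | yes refl = ~-tail (hamming≡1⇒~ x y h)
... | no  a≢b with hamming≡0⇒≡ x y (suc-injective h)
...   | refl = ~-head a≢b

Toward : (x y : Vec (Fin s) n) → ℕ → Set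
Toward x y d = Σ[ z ∈ _ ] x ~ z × hamming z y ≡ d

toward : (x y : Vec (Fin s) n) {d : ℕ} → hamming x y ≡ suc d → Toward x y d
toward []      []      ()
toward (a ∷ x) (b ∷ y) h with a ≟ b
... | yes refl = let z , x~z , zy = toward x y h
                 in a ∷ z , ~-tail x~z , trans (hamming-∷-≡ a z y) zy
... | no  a≢b  = b ∷ x , ~-head a≢b , trans (hamming-∷-≡ b x y) (suc-injective h)

record Fork (x y : Vec (Fin s) n) (d : ℕ) : Set where
  field
    left right : Toward x y d
    apart      : hamming (proj₁ left) (proj₁ right) ≡ 2

fork : (x y : Vec (Fin s) n) {d : ℕ} → hamming x y ≡ suc (suc d) → Fork x y (suc d)
fork []      []      ()
fork (a ∷ x) (b ∷ y) h with a ≟ b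
... | yes refl = record
  { left  = extend left
  ; right = extend right
  ; apart = trans (hamming-∷-≡ a (proj₁ left) (proj₁ right)) apart
  }
  where
  open Fork (fork x y h)
  extend : Toward x y _ → Toward (a ∷ x) (a ∷ y) _
  extend (z , x~z , zy) = a ∷ z , ~-tail x~z , trans (hamming-∷-≡ a z y) zy
... | no a≢b with toward x y (suc-injective h)
...   | z , x~z , zy = record
  { left  = b ∷ x , ~-head a≢b , trans (hamming-∷-≡ b x y) (suc-injective h)
  ; right = a ∷ z , ~-tail x~z , trans (hamming-∷-≢ a≢b z y) (cong suc zy)
  ; apart = trans (hamming-∷-≢ (≢-sym a≢b) x z) (cong suc (~⇒hamming≡1 x z x~z))
  }

record Corner (P Q : Vec (Fin s) n) : Set where
  field
    {source target} : Vec (Fin s) n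
    source~P : source ~ P
    P~target : P ~ target
    far      : hamming source target ≡ 2
    between  : ∀ z → source ~ z → z ~ target → z ≡ P ⊎ z ≡ Q

corner : (P Q : Vec (Fin s) n) → hamming P Q ≡ 2 → Corner P Q
corner []      []      ()
corner (a ∷ P) (b ∷ Q) h with a ≟ b
... | yes refl = record
  { source~P = ~-tail source~P
  ; P~target = ~-tail P~target
  ; far      = trans (hamming-∷-≡ a source target) far
  ; between  = between′
  }
  where
  open Corner (corner P Q h)
  between′ : ∀ z → (a ∷ source) ~ z → z ~ (a ∷ target) → z ≡ a ∷ P ⊎ z ≡ a ∷ Q
  between′ (c ∷ z) s~z z~t with ∷-~⁻ s~z | ∷-~⁻ z~t
  ... | inj₁ (_ , s≡z)    | inj₁ (_ , z≡t)    = contradiction (trans s≡z z≡t) (hamming-suc⇒≢ far)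
  ... | inj₁ (a≢c , _)    | inj₂ (refl , _)   = contradiction refl a≢c
  ... | inj₂ (refl , _)   | inj₁ (c≢a , _)    = contradiction refl c≢a
  ... | inj₂ (refl , s~z) | inj₂ (_ , z~t) with between z s~z z~t
  ...   | inj₁ refl = inj₁ refl
  ...   | inj₂ refl = inj₂ refl
... | no a≢b = record
  { source~P = ~-head (≢-sym a≢b)
  ; P~target = ~-tail (hamming≡1⇒~ P Q PQ)
  ; far      = trans (hamming-∷-≢ (≢-sym a≢b) P Q) (cong suc PQ)
  ; between  = between′
  }
  where
  PQ : hamming P Q ≡ 1
  PQ = suc-injective h
  between′ : ∀ z → (b ∷ P) ~ z → z ~ (a ∷ Q) → z ≡ a ∷ P ⊎ z ≡ b ∷ Q
  between′ (c ∷ z) s~z z~t with ∷-~⁻ s~z | ∷-~⁻ z~t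
  ... | inj₁ (_ , P≡z)  | inj₁ (_ , z≡Q)  = contradiction (trans P≡z z≡Q) (hamming-suc⇒≢ PQ)
  ... | inj₁ (_ , refl) | inj₂ (refl , _) = inj₁ refl
  ... | inj₂ (refl , _) | inj₁ (_ , refl) = inj₂ refl
  ... | inj₂ (refl , _) | inj₂ (refl , _) = contradiction refl a≢b

Distance2Free : List (Vec (Fin s) n) → Set
Distance2Free X = ∀ {P Q} → P ∈ X → Q ∈ X → hamming P Q ≢ 2

module _ {s n : ℕ} where
  open Graph (HammingAdj s n)

  hamming≤len : {x y : Vec (Fin s) n} (p : Walk x y) → hamming x y ≤ len p
  hamming≤len {x} []                       = ≤-reflexive (hamming-self x)
  hamming≤len {x} {y} (_∷_ {y = z} x~z p) = begin
    hamming x y               ≤⟨ hamming-triangle x z y ⟩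
    hamming x z + hamming z y ≡⟨ cong (_+ hamming z y) (~⇒hamming≡1 x z x~z) ⟩
    suc (hamming z y)         ≤⟨ s≤s (hamming≤len p) ⟩
    suc (len p)               ∎
    where open ≤-Reasoning

  module _ {X : List (Vec (Fin s) n)} (free : Distance2Free X) where
    open DecMembership (Vec.≡-dec {A = Fin s} {n = n} _≟_) using (_∈?_)

    avoidingStep : {x y : Vec (Fin s) n} {d : ℕ} → Fork x y d →
                   Σ[ z ∈ Vec (Fin s) n ] x ~ z × z ∉ X × hamming z y ≡ d
    avoidingStep record { left = z₁ , x~z₁ , z₁y ; right = z₂ , x~z₂ , z₂y ; apart = apart }
      with z₁ ∈? X | z₂ ∈? X
    ... | no z₁∉X  | _        = z₁ , x~z₁ , z₁∉X , z₁y
    ... | yes _    | no z₂∉X = z₂ , x~z₂ , z₂∉X , z₂y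
    ... | yes z₁∈X | yes z₂∈X = contradiction apart (free z₁∈X z₂∈X)

    AvoidingWalk : Vec (Fin s) n → Vec (Fin s) n → ℕ → Set
    AvoidingWalk x y d = Σ[ p ∈ Walk x y ] len p ≡ d × All (_∉ X) (inner p)

    prepend : {x z y : Vec (Fin s) n} {d : ℕ} →
              x ~ z → z ∉ X → AvoidingWalk z y (suc d) → AvoidingWalk x y (suc (suc d))
    prepend x~z z∉X (p@(_ ∷ _) , refl , avoids) = x~z ∷ p , refl , z∉X All.∷ avoids

    avoidingGeodesic : ∀ d (x y : Vec (Fin s) n) → hamming x y ≡ d → AvoidingWalk x y d
    avoidingGeodesic zero          x y h with hamming≡0⇒≡ x y h
    ... | refl = [] , refl , All.[]
    avoidingGeodesic (suc zero)    x y h = hamming≡1⇒~ x y h ∷ [] , refl , All.[]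
    avoidingGeodesic (suc (suc d)) x y h =
      let z , x~z , z∉X , zy = avoidingStep (fork x y h)
      in prepend x~z z∉X (avoidingGeodesic (suc d) z y zy)

    distance2Free⇒visible : ∀ x y → Visible X x y
    distance2Free⇒visible x y with avoidingGeodesic _ x y refl
    ... | p , len-p , avoids =
      p , (λ q → subst (_≤ len q) (sym len-p) (hamming≤len q)) , avoids

  totalMV⇒distance2Free : {X : List (Vec (Fin s) n)} → IsTotalMV X → Distance2Free X
  totalMV⇒distance2Free {X} (_ , visible) {P} {Q} P∈X Q∈X PQ =
    let p , shortest , avoids = visible source target in
    noDetour p (≤-antisym (shortest (_∷_ {y = P} source~P (P~target ∷ [])))
                          (subst (_≤ len p) far (hamming≤len p)))
             avoids between∈X
    where
    open Corner (corner P Q PQ)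
    between∈X : ∀ z → source ~ z → z ~ target → z ∈ X
    between∈X z s~z z~t with between z s~z z~t
    ... | inj₁ refl = P∈X
    ... | inj₂ refl = Q∈X
    noDetour : {x y : Vec (Fin s) n} (p : Walk x y) → len p ≡ 2 →
               All (_∉ X) (inner p) → (∀ z → x ~ z → z ~ y → z ∈ X) → ⊥
    noDetour (_∷_ {y = z} e₁ (e₂ ∷ [])) _ (z∉X All.∷ _) inX = z∉X (inX z e₁ e₂)
    noDetour []              () _ _
    noDetour (_ ∷ [])        () _ _
    noDetour (_ ∷ _ ∷ _ ∷ _) () _ _

length-cartesianProductWith : {A B C : Set} (f : A → B → C) (xs : List A) (ys : List B) →
  length (cartesianProductWith f xs ys) ≡ length xs * length ys
length-cartesianProductWith f List.[]       ys = refl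
length-cartesianProductWith f (x List.∷ xs) ys = begin
  length (List.map (f x) ys ++ cartesianProductWith f xs ys)
    ≡⟨ length-++ (List.map (f x) ys) ⟩
  length (List.map (f x) ys) + length (cartesianProductWith f xs ys)
    ≡⟨ cong₂ _+_ (length-map (f x) ys) (length-cartesianProductWith f xs ys) ⟩
  length ys + length xs * length ys ∎
  where open ≡-Reasoning

allVecs : ∀ t n → List (Vec (Fin t) n)
allVecs t zero    = [] List.∷ List.[]
allVecs t (suc n) = cartesianProductWith _∷_ (allFin t) (allVecs t n)

length-allVecs : ∀ t n → length (allVecs t n) ≡ t ^ n
length-allVecs t zero    = refl
length-allVecs t (suc n) =
  trans (length-cartesianProductWith _∷_ (allFin t) (allVecs t n))
        (cong₂ _*_ (length-tabulate {n = t} id) (length-allVecs t n))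

allVecs-unique : ∀ t n → Unique (allVecs t n)
allVecs-unique t zero    = All.[] AllPairs.∷ AllPairs.[]
allVecs-unique t (suc n) =
  Unique.cartesianProductWith⁺ _∷_ Vec.∷-injective (Unique.allFin⁺ t) (allVecs-unique t n)

∈-allVecs : (x : Vec (Fin t) n) → x ∈ allVecs t n
∈-allVecs []      = here refl
∈-allVecs (a ∷ x) = ∈-cartesianProductWith⁺ _∷_ (∈-allFin a) (∈-allVecs x)

injectiveOn⇒length≤ : {A B : Set} (f : A → B) (xs : List A) {ys : List B} → Unique xs →
  (∀ {x y} → x ∈ xs → y ∈ xs → f x ≡ f y → x ≡ y) →
  (∀ {x} → x ∈ xs → f x ∈ ys) → length xs ≤ length ys
injectiveOn⇒length≤ f List.[]       _                       _         _    = z≤n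
injectiveOn⇒length≤ f (x List.∷ xs) (x∉xs AllPairs.∷ unique) injective into
  with ∈-∃++ (into (here refl))
... | ys₁ , ys₂ , refl = begin
  suc (length xs)             ≤⟨ s≤s (injectiveOn⇒length≤ f xs unique
                                       (λ p q → injective (there p) (there q)) into′) ⟩
  suc (length (ys₁ ++ ys₂))   ≡⟨ ↭-length (shift (f x) ys₁ ys₂) ⟨
  length (ys₁ ++ f x List.∷ ys₂) ∎
  where
  open ≤-Reasoning
  into′ : ∀ {y} → y ∈ xs → f y ∈ ys₁ ++ ys₂
  into′ y∈xs with ∈-resp-↭ (shift (f x) ys₁ ys₂) (into (there y∈xs))
  ... | here fy≡fx = contradiction (injective (there y∈xs) (here refl) fy≡fx)
                                   (≢-sym (All.lookup x∉xs y∈xs))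
  ... | there fy∈  = fy∈

hamming-differ₀₁ : {a₁ a₂ b₁ b₂ : Fin s} → ∀ c (t : Vec (Fin s) n) → a₁ ≢ b₁ → a₂ ≢ b₂ →
                   hamming (a₁ ∷ a₂ ∷ c ∷ t) (b₁ ∷ b₂ ∷ c ∷ t) ≡ 2
hamming-differ₀₁ c t p q =
  cong₂ _+_ (mismatch-≢ p) (cong₂ _+_ (mismatch-≢ q) (cong₂ _+_ (mismatch-self c) (hamming-self t)))

hamming-differ₀₂ : {a₁ a₃ b₁ b₃ : Fin s} → ∀ c (t : Vec (Fin s) n) → a₁ ≢ b₁ → a₃ ≢ b₃ →
                   hamming (a₁ ∷ c ∷ a₃ ∷ t) (b₁ ∷ c ∷ b₃ ∷ t) ≡ 2
hamming-differ₀₂ c t p q =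
  cong₂ _+_ (mismatch-≢ p) (cong₂ _+_ (mismatch-self c) (cong₂ _+_ (mismatch-≢ q) (hamming-self t)))

hamming-differ₁₂ : {a₂ a₃ b₂ b₃ : Fin s} → ∀ c (t : Vec (Fin s) n) → a₂ ≢ b₂ → a₃ ≢ b₃ →
                   hamming (c ∷ a₂ ∷ a₃ ∷ t) (c ∷ b₂ ∷ b₃ ∷ t) ≡ 2
hamming-differ₁₂ c t p q =
  cong₂ _+_ (mismatch-self c) (cong₂ _+_ (mismatch-≢ p) (cong₂ _+_ (mismatch-≢ q) (hamming-self t)))

module _ {s k : ℕ} where

  private
    Point = Vec (Fin s) (3 + k)
    _≟ᵥ_ : ∀ {m} → (x y : Vec (Fin s) m) → Dec (x ≡ y)
    _≟ᵥ_ = Vec.≡-dec _≟_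

  project : Fin 3 → Point → Vec (Fin s) (suc k)
  project zero             (a ∷ _ ∷ _ ∷ t) = a ∷ t
  project (suc zero)       (_ ∷ b ∷ _ ∷ t) = b ∷ t
  project (suc (suc zero)) (_ ∷ _ ∷ c ∷ t) = c ∷ t

  module _ {X : List Point} (free : Distance2Free X) where

    Crowded : Fin 3 → Point → Set
    Crowded i x = Any (λ y → project i y ≡ project i x × y ≢ x) X

    crowded? : ∀ i x → Dec (Crowded i x)
    crowded? i x = any? (λ y → (project i y ≟ᵥ project i x) ×-dec ¬? (y ≟ᵥ x)) X

    neighbour₁⇒¬crowded₁ : ∀ {a₁ a₂ a₃ b t} → (a₁ ∷ a₂ ∷ a₃ ∷ t) ∈ X → (a₁ ∷ b ∷ a₃ ∷ t) ∈ X →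
                           a₂ ≢ b → ¬ Crowded (suc zero) (a₁ ∷ a₂ ∷ a₃ ∷ t)
    neighbour₁⇒¬crowded₁ {a₁} {a₂} {a₃} {t = t} x∈X y∈X a₂≢b crowded with find crowded
    ... | (c₁ ∷ _ ∷ c₃ ∷ _) , z∈X , refl , z≢x with a₁ ≟ c₁ | a₃ ≟ c₃
    ...   | yes refl | yes refl = z≢x refl
    ...   | no p     | no q     = free x∈X z∈X (hamming-differ₀₂ a₂ t p q)
    ...   | no p     | yes refl = free y∈X z∈X (hamming-differ₀₁ a₃ t p (≢-sym a₂≢b))
    ...   | yes refl | no q     = free y∈X z∈X (hamming-differ₁₂ a₁ t (≢-sym a₂≢b) q)

    neighbour₂⇒¬crowded₂ : ∀ {a₁ a₂ a₃ b t} → (a₁ ∷ a₂ ∷ a₃ ∷ t) ∈ X → (a₁ ∷ a₂ ∷ b ∷ t) ∈ X →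
                           a₃ ≢ b → ¬ Crowded (suc (suc zero)) (a₁ ∷ a₂ ∷ a₃ ∷ t)
    neighbour₂⇒¬crowded₂ {a₁} {a₂} {a₃} {t = t} x∈X y∈X a₃≢b crowded with find crowded
    ... | (d₁ ∷ d₂ ∷ _ ∷ _) , z∈X , refl , z≢x with a₁ ≟ d₁ | a₂ ≟ d₂
    ...   | yes refl | yes refl = z≢x refl
    ...   | no p     | no q     = free x∈X z∈X (hamming-differ₀₁ a₃ t p q)
    ...   | no p     | yes refl = free y∈X z∈X (hamming-differ₀₂ a₂ t p (≢-sym a₃≢b))
    ...   | yes refl | no q     = free y∈X z∈X (hamming-differ₁₂ a₁ t q (≢-sym a₃≢b))

    ¬crowded-everywhere : {x : Point} → x ∈ X →
      Crowded zero x → Crowded (suc zero) x → Crowded (suc (suc zero)) x → ⊥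
    ¬crowded-everywhere {a₁ ∷ a₂ ∷ a₃ ∷ t} x∈X crowded₀ crowded₁ crowded₂ with find crowded₀
    ... | (_ ∷ b₂ ∷ b₃ ∷ _) , y∈X , refl , y≢x with a₂ ≟ b₂ | a₃ ≟ b₃
    ...   | yes refl | yes refl = y≢x refl
    ...   | no p     | no q     = free x∈X y∈X (hamming-differ₁₂ a₁ t p q)
    ...   | no p     | yes refl = neighbour₁⇒¬crowded₁ x∈X y∈X p crowded₁
    ...   | yes refl | no q     = neighbour₂⇒¬crowded₂ x∈X y∈X q crowded₂

    lonelyAxis : Point → Fin 3
    lonelyAxis x with crowded? zero x | crowded? (suc zero) x
    ... | no  _ | _     = zero
    ... | yes _ | no  _ = suc zero
    ... | yes _ | yes _ = suc (suc zero)

    lonelyAxis-uncrowded : {x : Point} → x ∈ X → ¬ Crowded (lonelyAxis x) x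
    lonelyAxis-uncrowded {x} x∈X with crowded? zero x | crowded? (suc zero) x
    ... | no  ¬crowded₀ | _             = ¬crowded₀
    ... | yes crowded₀  | no ¬crowded₁ = ¬crowded₁
    ... | yes crowded₀  | yes crowded₁  = ¬crowded-everywhere x∈X crowded₀ crowded₁

    signature : Point → Fin 3 × Vec (Fin s) (suc k)
    signature x = lonelyAxis x , project (lonelyAxis x) x

    signature-injectiveOn : {x y : Point} → x ∈ X → y ∈ X → signature x ≡ signature y → x ≡ y
    signature-injectiveOn {x} {y} x∈X y∈X eq = decidable-stable (x ≟ᵥ y) λ x≢y →
      lonelyAxis-uncrowded x∈X (lose y∈X (sameProjection , ≢-sym x≢y))
      where
      sameProjection : project (lonelyAxis x) y ≡ project (lonelyAxis x) x
      sameProjection = trans (cong (λ i → project i y) (cong proj₁ eq)) (sym (cong proj₂ eq))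

  distance2Free-length≤ : {X : List Point} → Unique X → Distance2Free X → length X ≤ 3 * s ^ suc k
  distance2Free-length≤ {X} unique free = begin
    length X
      ≤⟨ injectiveOn⇒length≤ (signature free) X unique (signature-injectiveOn free) (λ _ → ∈-signatures) ⟩
    length signatures
      ≡⟨ length-cartesianProductWith _,_ (allFin 3) (allVecs s (suc k)) ⟩
    length (allFin 3) * length (allVecs s (suc k))
      ≡⟨ cong₂ _*_ (length-tabulate {n = 3} id) (length-allVecs s (suc k)) ⟩
    3 * s ^ suc k ∎
    where
    open ≤-Reasoning
    signatures = cartesianProductWith _,_ (allFin 3) (allVecs s (suc k))
    ∈-signatures : {σ : Fin 3 × Vec (Fin s) (suc k)} → σ ∈ signatures
    ∈-signatures {i , v} = ∈-cartesianProductWith⁺ _,_ (∈-allFin i) (∈-allVecs v)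

module _ {m : ℕ} where

  moment₀ : Vec (Fin m) n → ℕ
  moment₀ []      = 0
  moment₀ (a ∷ u) = toℕ a + moment₀ u

  -- moment₁ u = Σᵢ (i + 1) · uᵢ
  moment₁ : Vec (Fin m) n → ℕ
  moment₁ []      = 0
  moment₁ (a ∷ u) = moment₀ (a ∷ u) + moment₁ u

  moment₀≤ : (u : Vec (Fin m) n) → moment₀ u ≤ n * m
  moment₀≤ []      = z≤n
  moment₀≤ (a ∷ u) = +-mono-≤ (<⇒≤ (Fin.toℕ<n a)) (moment₀≤ u)

  moment₀< : (u : Vec (Fin m) (suc n)) → moment₀ u < suc n * m
  moment₀< (a ∷ u) = +-mono-<-≤ (Fin.toℕ<n a) (moment₀≤ u)

  moment₁≤ : (u : Vec (Fin m) n) → moment₁ u ≤ n * moment₀ u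
  moment₁≤ []              = z≤n
  moment₁≤ {suc n} (a ∷ u) =
    +-monoʳ-≤ (moment₀ (a ∷ u)) (≤-trans (moment₁≤ u) (*-monoʳ-≤ n (m≤n+m (moment₀ u) (toℕ a))))

  record _≺_ (u v : Vec (Fin m) n) : Set where
    constructor _,_
    field
      moment₀-< : moment₀ u < moment₀ v
      moment₁-< : moment₁ u < moment₁ v

  ≺-∷ : (a : Fin m) {u v : Vec (Fin m) n} → u ≺ v → (a ∷ u) ≺ (a ∷ v)
  ≺-∷ a (<₀ , <₁) = +-monoʳ-< (toℕ a) <₀ , +-mono-< (+-monoʳ-< (toℕ a) <₀) <₁

  ≺-head : {a b : Fin m} (u : Vec (Fin m) n) → toℕ a < toℕ b → (a ∷ u) ≺ (b ∷ u)
  ≺-head u a<b = +-monoˡ-< (moment₀ u) a<b , +-monoˡ-< (moment₁ u) (+-monoˡ-< (moment₀ u) a<b)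

  hamming≡1⇒≺⊎≻ : (u v : Vec (Fin m) n) → hamming u v ≡ 1 → u ≺ v ⊎ v ≺ u
  hamming≡1⇒≺⊎≻ []      []      ()
  hamming≡1⇒≺⊎≻ (a ∷ u) (b ∷ v) h with a ≟ b
  ... | yes refl = Sum.map (≺-∷ a) (≺-∷ a) (hamming≡1⇒≺⊎≻ u v h)
  ... | no a≢b with hamming≡0⇒≡ u v (suc-injective h)
  ...   | refl with Fin.<-cmp a b
  ...     | tri< a<b _   _   = inj₁ (≺-head u a<b)
  ...     | tri≈ _   a≡b _   = contradiction a≡b a≢b
  ...     | tri> _   _   b<a = inj₂ (≺-head u b<a)

  ≺⊎≻⇒moment₀≢ : {u v : Vec (Fin m) n} → u ≺ v ⊎ v ≺ u → moment₀ u ≢ moment₀ v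
  ≺⊎≻⇒moment₀≢ (inj₁ u≺v) = <⇒≢ (_≺_.moment₀-< u≺v)
  ≺⊎≻⇒moment₀≢ (inj₂ v≺u) = >⇒≢ (_≺_.moment₀-< v≺u)

  ≺⊎≻⇒moment₁≢ : {u v : Vec (Fin m) n} → u ≺ v ⊎ v ≺ u → moment₁ u ≢ moment₁ v
  ≺⊎≻⇒moment₁≢ (inj₁ u≺v) = <⇒≢ (_≺_.moment₁-< u≺v)
  ≺⊎≻⇒moment₁≢ (inj₂ v≺u) = >⇒≢ (_≺_.moment₁-< v≺u)

  moment₁-tail : (a b : Fin m) (u v : Vec (Fin m) n) →
    moment₀ (a ∷ u) ≡ moment₀ (b ∷ v) → moment₁ (a ∷ u) ≡ moment₁ (b ∷ v) → moment₁ u ≡ moment₁ v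
  moment₁-tail a b u v e₀ e₁ =
    +-cancelˡ-≡ (moment₀ (a ∷ u)) _ _ (trans e₁ (cong (_+ moment₁ v) (sym e₀)))

  hamming≡2⇒moments≢ : (u v : Vec (Fin m) n) → hamming u v ≡ 2 →
                       moment₀ u ≡ moment₀ v → moment₁ u ≢ moment₁ v
  hamming≡2⇒moments≢ []      []      ()
  hamming≡2⇒moments≢ (a ∷ u) (b ∷ v) h e₀ e₁ with a ≟ b
  ... | yes refl = hamming≡2⇒moments≢ u v h (+-cancelˡ-≡ (toℕ a) _ _ e₀) (moment₁-tail a a u v e₀ e₁)
  ... | no _     = ≺⊎≻⇒moment₁≢ (hamming≡1⇒≺⊎≻ u v (suc-injective h)) (moment₁-tail a b u v e₀ e₁)

module _ {s m n : ℕ} (fits : suc n * (suc n * m) ≤ s) where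

  private
    N = suc n

  m≤s : m ≤ s
  m≤s = ≤-trans (m≤n*m m N) (≤-trans (m≤n*m (N * m) N) fits)

  moment₀<s : (u : Vec (Fin m) N) → moment₀ u < s
  moment₀<s u = <-≤-trans (moment₀< u) (≤-trans (m≤n*m (N * m) N) fits)

  moment₁<s : (u : Vec (Fin m) N) → moment₁ u < s
  moment₁<s u = ≤-<-trans (moment₁≤ u) (<-≤-trans (*-monoʳ-< N (moment₀< u)) fits)

  widen : Fin m → Fin s
  widen a = inject≤ a m≤s

  hamming-widen : (u v : Vec (Fin m) N) → hamming (map widen u) (map widen v) ≡ hamming u v
  hamming-widen = hamming-map (Fin.inject≤-injective m≤s m≤s _ _)

  encode : Vec (Fin m) N → Vec (Fin s) (3 + n)
  encode u = fromℕ< (moment₀<s u) ∷ fromℕ< (moment₁<s u) ∷ map widen u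

  encode-injective : {u v : Vec (Fin m) N} → encode u ≡ encode v → u ≡ v
  encode-injective {u} {v} eq = hamming≡0⇒≡ u v (begin
    hamming u v                         ≡⟨ hamming-widen u v ⟨
    hamming (map widen u) (map widen v) ≡⟨ cong (λ w → hamming w (map widen v)) widened ⟩
    hamming (map widen v) (map widen v) ≡⟨ hamming-self (map widen v) ⟩
    0                                   ∎)
    where
    open ≡-Reasoning
    widened = Vec.∷-injectiveʳ (Vec.∷-injectiveʳ eq)

  encode-apart : (u v : Vec (Fin m) N) → hamming (encode u) (encode v) ≢ 2
  encode-apart u v with fromℕ< (moment₀<s u) ≟ fromℕ< (moment₀<s v)
                      | fromℕ< (moment₁<s u) ≟ fromℕ< (moment₁<s v)
  ... | yes e₀ | yes e₁ = λ h →
    hamming≡2⇒moments≢ u v (trans (sym (hamming-widen u v)) h)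
      (Fin.fromℕ<-injective _ _ _ _ e₀) (Fin.fromℕ<-injective _ _ _ _ e₁)
  ... | yes e₀ | no _ = λ h →
    ≺⊎≻⇒moment₀≢ (hamming≡1⇒≺⊎≻ u v (trans (sym (hamming-widen u v)) (suc-injective h)))
      (Fin.fromℕ<-injective _ _ _ _ e₀)
  ... | no _ | yes e₁ = λ h →
    ≺⊎≻⇒moment₁≢ (hamming≡1⇒≺⊎≻ u v (trans (sym (hamming-widen u v)) (suc-injective h)))
      (Fin.fromℕ<-injective _ _ _ _ e₁)
  ... | no ≢₀ | no _ = λ h →
    ≢₀ (cong (λ w → fromℕ< (moment₀<s w))
             (hamming≡0⇒≡ u v (trans (sym (hamming-widen u v)) (suc-injective (suc-injective h)))))

  encodedSet : List (Vec (Fin s) (3 + n))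
  encodedSet = List.map encode (allVecs m N)

  encodedSet-totalMV : Graph.IsTotalMV (HammingAdj s (3 + n)) encodedSet
  encodedSet-totalMV = Unique.map⁺ encode-injective (allVecs-unique m N) , distance2Free⇒visible free
    where
    free : Distance2Free encodedSet
    free P∈ Q∈ with ∈-map⁻ encode P∈ | ∈-map⁻ encode Q∈
    ... | u , _ , refl | v , _ , refl = encode-apart u v

  length-encodedSet : length encodedSet ≡ m ^ N
  length-encodedSet = trans (length-map encode (allVecs m N)) (length-allVecs m N)

^-distribʳ-* : ∀ a b n → (a * b) ^ n ≡ a ^ n * b ^ n
^-distribʳ-* a b zero    = refl
^-distribʳ-* a b (suc n) = begin
  (a * b) * (a * b) ^ n     ≡⟨ cong ((a * b) *_) (^-distribʳ-* a b n) ⟩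
  (a * b) * (a ^ n * b ^ n) ≡⟨ interchange *-commutativeSemigroup a b (a ^ n) (b ^ n) ⟩
  (a * a ^ n) * (b * b ^ n) ∎
  where open ≡-Reasoning

m≤2n*[m/n] : ∀ m n .{{_ : ℕ.NonZero n}} → n ≤ m → m ≤ 2 * n * (m / n)
m≤2n*[m/n] m n n≤m = begin
  m                         ≡⟨ m≡m%n+[m/n]*n m n ⟩
  m % n + m / n * n         ≤⟨ +-monoˡ-≤ (m / n * n) (<⇒≤ (m%n<n m n)) ⟩
  n + m / n * n             ≤⟨ +-monoˡ-≤ (m / n * n) (m≤m*n n (m / n) {{ℕ.>-nonZero (m≥n⇒m/n>0 n≤m)}}) ⟩
  n * (m / n) + m / n * n   ≡⟨ cong (n * (m / n) +_) (*-comm (m / n) n) ⟩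
  n * (m / n) + n * (m / n) ≡⟨ cong (n * (m / n) +_) (sym (+-identityʳ (n * (m / n)))) ⟩
  2 * (n * (m / n))         ≡⟨ *-assoc 2 n (m / n) ⟨
  2 * n * (m / n)           ∎
  where open ≤-Reasoning

μt-upper : ∀ {s k μ} → MuTHamming s (3 + k) μ → μ ≤ 3 * s ^ suc k
μt-upper ((X , X-totalMV , refl) , _) =
  distance2Free-length≤ (proj₁ X-totalMV) (totalMV⇒distance2Free X-totalMV)

μt-lower : ∀ {s k μ} → suc k * suc k ≤ s → MuTHamming s (3 + k) μ →
           s ^ suc k ≤ (2 * (suc k * suc k)) ^ suc k * μ
μt-lower {s} {k} {μ} K≤s (_ , maximal) = begin
  s ^ N                ≤⟨ ^-monoˡ-≤ N (m≤2n*[m/n] s K K≤s) ⟩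
  (2 * K * m) ^ N      ≡⟨ ^-distribʳ-* (2 * K) m N ⟩
  (2 * K) ^ N * m ^ N  ≤⟨ *-monoʳ-≤ ((2 * K) ^ N) m^N≤μ ⟩
  (2 * K) ^ N * μ      ∎
  where
  open ≤-Reasoning
  N = suc k
  K = N * N
  m = s / K
  fits : N * (N * m) ≤ s
  fits = subst (_≤ s) (trans (*-comm m K) (*-assoc N N m)) (m/n*n≤m s K)
  m^N≤μ : m ^ N ≤ μ
  m^N≤μ = subst (_≤ μ) (length-encodedSet {m = m} fits) (maximal _ (encodedSet-totalMV {m = m} fits))

theorem1p3 : ∀ (r : ℕ) → 3 ≤ r →
    Σ ℕ λ a → Σ ℕ λ c → Σ ℕ λ s₀ →
      ∀ (s m : ℕ) → s₀ ≤ s → MuTHamming s r m →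
        (s ^ (r ∸ 2) ≤ a * m) × (m ≤ c * s ^ (r ∸ 2))
theorem1p3 .(3 + k) (s≤s (s≤s (s≤s {n = k} z≤n))) =
  (2 * (suc k * suc k)) ^ suc k , 3 , suc k * suc k ,
  λ s μ K≤s isμt → μt-lower K≤s isμt , μt-upper isμt
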